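{- Assume $u, v \in V(G) \setminus (I_s \cup I_t)$ and $N(u) = N(v)$. Then $(G, k, I_s, I_t)$ is a yes-instance if and only if $(G - \{v\}, k, I_s, I_t)$ is a yes-instance.
   Context: $(G, k, I_s, I_t)$ is an instance of the Token Sliding problem: $G$ is a finite simple undirected graph (of girth five or more in the paper's setting) and $I_s, I_t$ are independent sets of $G$ of size $k \geq 1$; it is a yes-instance iff there is a sequence of independent sets of size $k$ from $I_s$ to $I_t$ in which consecutive sets satisfy $I_i \triangle I_{i+1} = \{x,y\} \in E(G)$ (one token slides along an edge). $N(u)$ denotes the open neighborhood of $u$, and $G - \{v\}$ is the graph obtained by deleting $v$. -}

module Defs where

open import Data.Nat using (ℕ; suc; _≥_)
open import Data.Fin using (Fin; punchIn)
open import Data.Fin.Subset using (Subset; _∈_; _∉_; ∣_∣)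
open import Data.Vec using (tabulate; lookup)
open import Data.Empty using (⊥)
open import Data.Product using (Σ; ∃; ∃-syntax; _×_; _,_)
open import Relation.Nullary using (¬_)
open import Relation.Binary.PropositionalEquality using (_≡_; _≢_)
open import Relation.Binary.Construct.Closure.ReflexiveTransitive using (Star)
open import Function.Bundles using (_⇔_)

record Graph (n : ℕ) : Set₁ where
  field
    Adj     : Fin n → Fin n → Set
    sym     : ∀ {x y} → Adj x y → Adj y x
    irrefl  : ∀ {x} → ¬ Adj x x
open Graph public

NoTriangle : ∀ {n} → Graph n → Set
NoTriangle G = ∀ a b c → Adj G a b → Adj G b c → Adj G c a → ⊥

NoFourCycle : ∀ {n} → Graph n → Set
NoFourCycle G = ∀ a b c d → a ≢ c → b ≢ d →
  Adj G a b → Adj G b c → Adj G c d → Adj G d a → ⊥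

GirthAtLeast5 : ∀ {n} → Graph n → Set
GirthAtLeast5 G = NoTriangle G × NoFourCycle G

Independent : ∀ {n} → Graph n → Subset n → Set
Independent G I = ∀ x y → x ∈ I → y ∈ I → ¬ Adj G x y

SameNeighbourhood : ∀ {n} → Graph n → Fin n → Fin n → Set
SameNeighbourhood G u v = ∀ w → Adj G u w ⇔ Adj G v w

Slide : ∀ {n} → Graph n → Subset n → Subset n → Set
Slide G I J = ∃[ x ] ∃[ y ] (Adj G x y × x ∈ I × x ∉ J × y ∈ J × y ∉ I ×
  (∀ z → z ≢ x → z ≢ y → (z ∈ I ⇔ z ∈ J)))

TSStep : ∀ {n} → Graph n → ℕ → Subset n → Subset n → Set
TSStep G k I J = Slide G I J × Independent G J × ∣ J ∣ ≡ k

-- (G, k, Is, It) is a yes-instance: a sequence of independent sets of size k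
-- from Is to It, consecutive ones related by a single slide.
-- (Is is assumed to be independent of size k by the instance hypotheses.)
YesInstance : ∀ {n} → Graph n → ℕ → Subset n → Subset n → Set
YesInstance G k Is It = Star (TSStep G k) Is It

deleteVertex : ∀ {m} → Graph (suc m) → Fin (suc m) → Graph m
deleteVertex G v = record
  { Adj    = λ i j → Adj G (punchIn v i) (punchIn v j)
  ; sym    = sym G
  ; irrefl = irrefl G
  }

-- A vertex subset of G, viewed as a vertex subset of G - {v}
-- (it is the same set whenever v is not in it).
restrict : ∀ {m} → Fin (suc m) → Subset (suc m) → Subset m
restrict v I = tabulate (λ i → lookup I (punchIn v i))

-- Token sliding sequences can be pushed forward along any full homomorphism f
-- (Adj (f a) (f b) ⇔ Adj a b) by taking images, as long as f is injective on
-- the two sets of every step. The inclusion G - {v} → G is such a map, which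
-- gives the backward direction. For the forward direction send v to its twin u:
-- since N(u) = N(v) this is a full homomorphism G → G - {v}, and it stays
-- injective along the sequence because no slide can make u and v both occupied
-- (a token entering v comes from a neighbour of v, hence of u).
module Submission where

open import Defs
open import Data.Nat using (ℕ; suc; _≥_)
open import Data.Fin using (Fin; zero; suc; punchIn; punchOut; _≟_)
open import Data.Fin.Properties
  using (suc-injective; punchIn-injective; punchIn-punchOut; punchOut-punchIn; punchOut-cong; punchInᵢ≢i)
open import Data.Fin.Subset using (Subset; _∈_; _∉_; _⊆_; ∣_∣; ⊥; ⁅_⁆; _∪_; outside; inside)
open import Data.Fin.Subset.Properties
  using (x∈⁅x⁆; x∈⁅y⁆⇒x≡y; x∈p∪q⁺; x∈p∪q⁻; ∪-identityˡ; ⊆-antisym; p⊆p∪q; q⊆p∪q; drop-not-there; ∉⊥; ∣⊥∣≡0)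
open import Data.Vec using (_∷_; []; here; there)
open import Data.Vec.Properties using (lookup∘tabulate; []=⇒lookup; lookup⇒[]=)
open import Data.Empty using (⊥-elim)
open import Data.Unit using (⊤; tt)
open import Data.Product using (∃-syntax; _×_; _,_; proj₁)
open import Data.Sum using (_⊎_; inj₁; inj₂)
open import Function using (_∘_; id)
open import Function.Bundles using (_⇔_; mk⇔; Equivalence)
open import Function.Properties.Equivalence using () renaming (refl to ⇔-refl; trans to ⇔-trans)
open import Relation.Nullary using (¬_; yes; no)
open import Relation.Binary.PropositionalEquality using (_≡_; _≢_; refl; cong)
import Relation.Binary.PropositionalEquality as ≡
open import Relation.Binary.Construct.Closure.ReflexiveTransitive using (Star; ε; _◅_)

InjectiveOn : ∀ {n n′} → (Fin n → Fin n′) → Subset n → Set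
InjectiveOn f p = ∀ {x y} → x ∈ p → y ∈ p → f x ≡ f y → x ≡ y

image : ∀ {n n′} → (Fin n → Fin n′) → Subset n → Subset n′
image f []             = ⊥
image f (outside ∷ p)  = image (f ∘ suc) p
image f (inside  ∷ p)  = ⁅ f zero ⁆ ∪ image (f ∘ suc) p

∈-image⁺ : ∀ {n n′} (f : Fin n → Fin n′) {p x} → x ∈ p → f x ∈ image f p
∈-image⁺ f {inside  ∷ p} here        = x∈p∪q⁺ (inj₁ (x∈⁅x⁆ (f zero)))
∈-image⁺ f {outside ∷ p} (there x∈p) = ∈-image⁺ (f ∘ suc) x∈p
∈-image⁺ f {inside  ∷ p} (there x∈p) = x∈p∪q⁺ (inj₂ (∈-image⁺ (f ∘ suc) x∈p))

∈-image⁻ : ∀ {n n′} (f : Fin n → Fin n′) {p y} → y ∈ image f p → ∃[ x ] x ∈ p × f x ≡ y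
∈-image⁻ f {[]} y∈ = ⊥-elim (∉⊥ y∈)
∈-image⁻ f {outside ∷ p} y∈ with ∈-image⁻ (f ∘ suc) y∈
... | x , x∈p , refl = suc x , there x∈p , refl
∈-image⁻ f {inside ∷ p} y∈ with x∈p∪q⁻ ⁅ f zero ⁆ (image (f ∘ suc) p) y∈
... | inj₁ y∈⁅⁆ = zero , here , ≡.sym (x∈⁅y⁆⇒x≡y (f zero) y∈⁅⁆)
... | inj₂ y∈′ with ∈-image⁻ (f ∘ suc) y∈′
...   | x , x∈p , refl = suc x , there x∈p , refl

∣⁅x⁆∪p∣≡1+∣p∣ : ∀ {n} (x : Fin n) {p} → x ∉ p → ∣ ⁅ x ⁆ ∪ p ∣ ≡ suc ∣ p ∣
∣⁅x⁆∪p∣≡1+∣p∣ zero    {outside ∷ p} _   = cong (suc ∘ ∣_∣) (∪-identityˡ p)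
∣⁅x⁆∪p∣≡1+∣p∣ zero    {inside  ∷ p} x∉p = ⊥-elim (x∉p here)
∣⁅x⁆∪p∣≡1+∣p∣ (suc x) {outside ∷ p} x∉p = ∣⁅x⁆∪p∣≡1+∣p∣ x (drop-not-there x∉p)
∣⁅x⁆∪p∣≡1+∣p∣ (suc x) {inside  ∷ p} x∉p = cong suc (∣⁅x⁆∪p∣≡1+∣p∣ x (drop-not-there x∉p))

InjectiveOn-tail : ∀ {n n′} {f : Fin (suc n) → Fin n′} {b p} →
                   InjectiveOn f (b ∷ p) → InjectiveOn (f ∘ suc) p
InjectiveOn-tail f-inj x∈p y∈p = suc-injective ∘ f-inj (there x∈p) (there y∈p)

∣image∣≡∣p∣ : ∀ {n n′} (f : Fin n → Fin n′) {p} → InjectiveOn f p → ∣ image f p ∣ ≡ ∣ p ∣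
∣image∣≡∣p∣ {n′ = n′} f {[]} _ = ∣⊥∣≡0 n′
∣image∣≡∣p∣ f {outside ∷ p} f-inj = ∣image∣≡∣p∣ (f ∘ suc) (InjectiveOn-tail f-inj)
∣image∣≡∣p∣ f {inside  ∷ p} f-inj = begin
  ∣ ⁅ f zero ⁆ ∪ image (f ∘ suc) p ∣ ≡⟨ ∣⁅x⁆∪p∣≡1+∣p∣ (f zero) f0∉ ⟩
  suc ∣ image (f ∘ suc) p ∣          ≡⟨ cong suc (∣image∣≡∣p∣ (f ∘ suc) (InjectiveOn-tail f-inj)) ⟩
  suc ∣ p ∣                          ∎
  where
  open ≡.≡-Reasoning
  f0∉ : f zero ∉ image (f ∘ suc) p
  f0∉ f0∈ with ∈-image⁻ (f ∘ suc) f0∈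
  ... | x , x∈p , fx≡f0 with f-inj (there x∈p) here fx≡f0
  ... | ()

IsFullHomomorphism : ∀ {n n′} → Graph n → Graph n′ → (Fin n → Fin n′) → Set
IsFullHomomorphism G H f = ∀ a b → Adj H (f a) (f b) ⇔ Adj G a b

module _ {n n′} {G : Graph n} {H : Graph n′} {f : Fin n → Fin n′}
         (f-full : IsFullHomomorphism G H f) where

  image-independent : ∀ {I} → Independent G I → Independent H (image f I)
  image-independent ind a b a∈ b∈ adj with ∈-image⁻ f a∈ | ∈-image⁻ f b∈
  ... | x , x∈I , refl | y , y∈I , refl = ind x y x∈I y∈I (Equivalence.to (f-full x y) adj)

  image-slide : ∀ {I J} → InjectiveOn f (I ∪ J) → Slide G I J → Slide H (image f I) (image f J)
  image-slide {I} {J} f-inj (x , y , xy , x∈I , x∉J , y∈J , y∉I , unchanged) =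
    f x , f y , Equivalence.from (f-full x y) xy ,
    ∈-image⁺ f x∈I , leaves (p⊆p∪q J) (q⊆p∪q I J) x∈I x∉J ,
    ∈-image⁺ f y∈J , leaves (q⊆p∪q I J) (p⊆p∪q J) y∈J y∉I ,
    λ w w≢fx w≢fy → mk⇔ (carry (λ z z≢x z≢y → Equivalence.to (unchanged z z≢x z≢y)) w≢fx w≢fy)
                        (carry (λ z z≢x z≢y → Equivalence.from (unchanged z z≢x z≢y)) w≢fx w≢fy)
    where
    leaves : ∀ {P Q a} → P ⊆ I ∪ J → Q ⊆ I ∪ J → a ∈ P → a ∉ Q → f a ∉ image f Q
    leaves P⊆ Q⊆ a∈P a∉Q fa∈ with ∈-image⁻ f fa∈
    ... | z , z∈Q , fz≡fa = a∉Q (≡.subst (_∈ _) (f-inj (Q⊆ z∈Q) (P⊆ a∈P) fz≡fa) z∈Q)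

    carry : ∀ {P Q w} → (∀ z → z ≢ x → z ≢ y → z ∈ P → z ∈ Q) →
            w ≢ f x → w ≢ f y → w ∈ image f P → w ∈ image f Q
    carry P⇒Q w≢fx w≢fy w∈ with ∈-image⁻ f w∈
    ... | z , z∈P , refl = ∈-image⁺ f (P⇒Q z (w≢fx ∘ cong f) (w≢fy ∘ cong f) z∈P)

  image-step : ∀ {k I J} → InjectiveOn f (I ∪ J) → TSStep G k I J → TSStep H k (image f I) (image f J)
  image-step {I = I} {J} f-inj (slide , ind , ∣J∣≡k) =
    image-slide f-inj slide , image-independent ind ,
    ≡.trans (∣image∣≡∣p∣ f (λ x∈J y∈J → f-inj (q⊆p∪q I J x∈J) (q⊆p∪q I J y∈J))) ∣J∣≡k

  image-reachable : ∀ {k} (P : Subset n → Set) →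
                    (∀ {I J} → P I → TSStep G k I J → P J × InjectiveOn f (I ∪ J)) →
                    ∀ {I J} → P I → Star (TSStep G k) I J → Star (TSStep H k) (image f I) (image f J)
  image-reachable P step⇒ PI ε        = ε
  image-reachable P step⇒ PI (s ◅ ss) with step⇒ PI s
  ... | PJ , f-inj = image-step f-inj s ◅ image-reachable P step⇒ PJ ss

module _ {m} (v : Fin (suc m)) where

  ∈-restrict⁺ : ∀ {I i} → punchIn v i ∈ I → i ∈ restrict v I
  ∈-restrict⁺ {I} {i} h = lookup⇒[]= i (restrict v I) (≡.trans (lookup∘tabulate _ i) ([]=⇒lookup h))

  ∈-restrict⁻ : ∀ {I i} → i ∈ restrict v I → punchIn v i ∈ I
  ∈-restrict⁻ {I} {i} h = lookup⇒[]= (punchIn v i) I (≡.trans (≡.sym (lookup∘tabulate _ i)) ([]=⇒lookup h))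

  punchIn-isFullHomomorphism : ∀ (G : Graph (suc m)) → IsFullHomomorphism (deleteVertex G v) G (punchIn v)
  punchIn-isFullHomomorphism G _ _ = mk⇔ id id

  punchIn-reachable : ∀ (G : Graph (suc m)) {k I J} → Star (TSStep (deleteVertex G v) k) I J →
                      Star (TSStep G k) (image (punchIn v) I) (image (punchIn v) J)
  punchIn-reachable G =
    image-reachable {G = deleteVertex G v} {H = G} (punchIn-isFullHomomorphism G)
      (λ _ → ⊤) (λ _ _ → tt , λ _ _ → punchIn-injective v _ _) tt

  image-punchIn-restrict : ∀ {I} → v ∉ I → image (punchIn v) (restrict v I) ≡ I
  image-punchIn-restrict {I} v∉I = ⊆-antisym ⊆I I⊆
    where
    ⊆I : image (punchIn v) (restrict v I) ⊆ I
    ⊆I w∈ with ∈-image⁻ (punchIn v) w∈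
    ... | i , i∈ , refl = ∈-restrict⁻ i∈
    I⊆ : I ⊆ image (punchIn v) (restrict v I)
    I⊆ {w} w∈I = ≡.subst (_∈ _) (punchIn-punchOut v≢w)
                   (∈-image⁺ (punchIn v) (∈-restrict⁺ (≡.subst (_∈ I) (≡.sym (punchIn-punchOut v≢w)) w∈I)))
      where
      v≢w : v ≢ w
      v≢w refl = v∉I w∈I

slide-keeps-twins-apart : ∀ {n} {G : Graph n} {u v I J} → u ≢ v → SameNeighbourhood G u v →
                          Independent G I → ¬ (u ∈ I × v ∈ I) → Slide G I J → ¬ (u ∈ I ∪ J × v ∈ I ∪ J)
slide-keeps-twins-apart {G = G} {u} {v} {I} {J} u≢v twins ind apart
                        (x , y , xy , x∈I , x∉J , _ , _ , unchanged) (u∈ , v∈)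
  with old-or-new u∈ | old-or-new v∈
  where
  old-or-new : ∀ {z} → z ∈ I ∪ J → z ∈ I ⊎ z ≡ y
  old-or-new {z} z∈ with x∈p∪q⁻ I J z∈ | z ≟ y | z ≟ x
  ... | inj₁ z∈I | _       | _       = inj₁ z∈I
  ... | inj₂ _   | yes z≡y | _       = inj₂ z≡y
  ... | inj₂ z∈J | no _    | yes refl = ⊥-elim (x∉J z∈J)
  ... | inj₂ z∈J | no z≢y  | no z≢x  = inj₁ (Equivalence.from (unchanged z z≢x z≢y) z∈J)
... | inj₁ u∈I | inj₁ v∈I = apart (u∈I , v∈I)
... | inj₁ u∈I | inj₂ refl = ind x u x∈I u∈I (sym G (Equivalence.from (twins x) (sym G xy)))
... | inj₂ refl | inj₁ v∈I = ind x v x∈I v∈I (sym G (Equivalence.to (twins x) (sym G xy)))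
... | inj₂ refl | inj₂ v≡u = u≢v (≡.sym v≡u)

module Merge {m} (G : Graph (suc m)) {u v : Fin (suc m)} (u≢v : u ≢ v)
             (twins : SameNeighbourhood G u v) where

  private
    v≢u : v ≢ u
    v≢u = u≢v ∘ ≡.sym

  merge : Fin (suc m) → Fin m
  merge z with v ≟ z
  ... | yes _   = punchOut v≢u
  ... | no v≢z = punchOut v≢z

  merge-punchIn : ∀ i → merge (punchIn v i) ≡ i
  merge-punchIn i with v ≟ punchIn v i
  ... | yes v≡vᵢ = ⊥-elim (punchInᵢ≢i v i (≡.sym v≡vᵢ))
  ... | no _     = ≡.trans (punchOut-cong v refl) (punchOut-punchIn v)

  punchIn-merge : ∀ z → (z ≡ v × punchIn v (merge z) ≡ u) ⊎ punchIn v (merge z) ≡ z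
  punchIn-merge z with v ≟ z
  ... | yes refl = inj₁ (refl , punchIn-punchOut v≢u)
  ... | no v≢z   = inj₂ (punchIn-punchOut v≢z)

  merge-adjˡ : ∀ a {w} → Adj G (punchIn v (merge a)) w ⇔ Adj G a w
  merge-adjˡ a {w} with punchIn-merge a
  ... | inj₁ (a≡v , e) = ≡.subst₂ (λ x y → Adj G x w ⇔ Adj G y w) (≡.sym e) (≡.sym a≡v) (twins w)
  ... | inj₂ e         = ≡.subst (λ x → Adj G x w ⇔ Adj G a w) (≡.sym e) ⇔-refl

  merge-isFullHomomorphism : IsFullHomomorphism G (deleteVertex G v) merge
  merge-isFullHomomorphism a b =
    ⇔-trans (merge-adjˡ a) (⇔-trans adj-comm (⇔-trans (merge-adjˡ b) adj-comm))
    where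
    adj-comm : ∀ {x y} → Adj G x y ⇔ Adj G y x
    adj-comm = mk⇔ (sym G) (sym G)

  merge-collision : ∀ {a b} → merge a ≡ merge b → a ≡ b ⊎ (a ≡ v × b ≡ u) ⊎ (a ≡ u × b ≡ v)
  merge-collision {a} {b} ma≡mb with punchIn-merge a | punchIn-merge b | cong (punchIn v) ma≡mb
  ... | inj₁ (a≡v , _)  | inj₁ (b≡v , _)  | _ = inj₁ (≡.trans a≡v (≡.sym b≡v))
  ... | inj₁ (a≡v , ea) | inj₂ eb         | r = inj₂ (inj₁ (a≡v , ≡.trans (≡.sym eb) (≡.trans (≡.sym r) ea)))
  ... | inj₂ ea         | inj₁ (b≡v , eb) | r = inj₂ (inj₂ (≡.trans (≡.sym ea) (≡.trans r eb) , b≡v))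
  ... | inj₂ ea         | inj₂ eb         | r = inj₁ (≡.trans (≡.sym ea) (≡.trans r eb))

  merge-injectiveOn : ∀ {p} → ¬ (u ∈ p × v ∈ p) → InjectiveOn merge p
  merge-injectiveOn {p} apart a∈p b∈p ma≡mb with merge-collision ma≡mb
  ... | inj₁ a≡b                  = a≡b
  ... | inj₂ (inj₁ (refl , refl)) = ⊥-elim (apart (b∈p , a∈p))
  ... | inj₂ (inj₂ (refl , refl)) = ⊥-elim (apart (a∈p , b∈p))

  image-merge : ∀ {I} → v ∉ I → image merge I ≡ restrict v I
  image-merge {I} v∉I = ⊆-antisym ⊆restrict restrict⊆
    where
    ⊆restrict : image merge I ⊆ restrict v I
    ⊆restrict w∈ with ∈-image⁻ merge w∈
    ... | z , z∈I , refl with punchIn-merge z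
    ...   | inj₁ (refl , _) = ⊥-elim (v∉I z∈I)
    ...   | inj₂ e          = ∈-restrict⁺ v (≡.subst (_∈ I) (≡.sym e) z∈I)
    restrict⊆ : restrict v I ⊆ image merge I
    restrict⊆ {i} i∈ = ≡.subst (_∈ _) (merge-punchIn i) (∈-image⁺ merge (∈-restrict⁻ v {I} i∈))

  merge-reachable : ∀ {k I J} → Independent G I → ¬ (u ∈ I × v ∈ I) → Star (TSStep G k) I J →
                    Star (TSStep (deleteVertex G v) k) (image merge I) (image merge J)
  merge-reachable indI apartI =
    image-reachable {G = G} {H = deleteVertex G v} merge-isFullHomomorphism
      (λ I → Independent G I × ¬ (u ∈ I × v ∈ I)) keeps-apart (indI , apartI)
    where
    keeps-apart : ∀ {k I J} → Independent G I × ¬ (u ∈ I × v ∈ I) → TSStep G k I J →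
                  (Independent G J × ¬ (u ∈ J × v ∈ J)) × InjectiveOn merge (I ∪ J)
    keeps-apart {I = I} {J} (indI , apartI) (slide , indJ , _) =
      (indJ , λ (u∈J , v∈J) → apartIJ (q⊆p∪q I J u∈J , q⊆p∪q I J v∈J)) , merge-injectiveOn apartIJ
      where
      apartIJ : ¬ (u ∈ I ∪ J × v ∈ I ∪ J)
      apartIJ = slide-keeps-twins-apart {G = G} u≢v twins indI apartI slide

lemma1 : ∀ {m} (G : Graph (suc m)) (k : ℕ) (Is It : Subset (suc m)) (u v : Fin (suc m)) →
    GirthAtLeast5 G → k ≥ 1 →
    Independent G Is → ∣ Is ∣ ≡ k → Independent G It → ∣ It ∣ ≡ k →
    u ≢ v → u ∉ Is → u ∉ It → v ∉ Is → v ∉ It →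
    SameNeighbourhood G u v →
    YesInstance G k Is It ⇔ YesInstance (deleteVertex G v) k (restrict v Is) (restrict v It)
lemma1 G k Is It u v _ _ indIs _ _ _ u≢v u∉Is _ v∉Is v∉It twins = mk⇔ delete restore
  where
  open Merge G u≢v twins

  delete : YesInstance G k Is It → YesInstance (deleteVertex G v) k (restrict v Is) (restrict v It)
  delete seq = ≡.subst₂ (Star _) (image-merge v∉Is) (image-merge v∉It)
                 (merge-reachable indIs (u∉Is ∘ proj₁) seq)

  restore : YesInstance (deleteVertex G v) k (restrict v Is) (restrict v It) → YesInstance G k Is It
  restore seq = ≡.subst₂ (Star _) (image-punchIn-restrict v v∉Is) (image-punchIn-restrict v v∉It)
                  (punchIn-reachable v G seq)
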